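{- Let $\mathcal{R}_r$ be the quasi-Riordan group. For every $[g,f]\in\mathcal{R}_r$, every conjugate $[d,h][g,f][d,h]^{ -1}$ with $[d,h]\in\mathcal{R}_r$ belongs to the set $\mathcal{R}(f)_r:=\{[e,f]: e\in\mathcal{F}_0,\ e(0)=1\}$. Consequently, $\mathcal{A}=\{[g,t]: g\in\mathcal{F}_0,\ g(0)=1\}$ is a normal subgroup of $\mathcal{R}_r$.
   Context: $\mathbb{K}$ is $\mathbb{R}$ or $\mathbb{C}$; $\mathcal{F}_r$ denotes the set of formal power series in $\mathbb{K}[[t]]$ of order $r$. For $g\in\mathcal{F}_0$ with $g(0)=1$ and $f\in\mathcal{F}_1$, the quasi-Riordan array $[g,f]$ is the infinite lower triangular matrix whose $0$th column has generating function $g$ and whose $j$th column, for $j\ge1$, has generating function $t^{j-1}f$. $\mathcal{R}_r$ is the set of all quasi-Riordan arrays, a group under matrix multiplication. -}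

module Defs where

open import Level using (Level; _⊔_)
open import Data.Nat using (ℕ; zero; suc)
open import Data.Product using (Σ; ∃; _×_; _,_)
open import Relation.Nullary using (¬_)
open import Algebra.Bundles using (CommutativeRing)

record IsField {c ℓ : Level} (K : CommutativeRing c ℓ) : Set (c ⊔ ℓ) where
  open CommutativeRing K using (Carrier; _≈_; _+_; _*_; 0#; 1#)
  field
    0≉1 : ¬ (0# ≈ 1#)
    inverse : ∀ x → ¬ (x ≈ 0#) → Σ Carrier (λ y → (x * y) ≈ 1#)

module QuasiRiordan {c ℓ : Level} (K : CommutativeRing c ℓ) where
  open CommutativeRing K using (Carrier; _≈_; _+_; _*_; 0#; 1#)

  Series : Set c
  Series = ℕ → Carrier

  -- infinite matrices, entry (i , j) = row i, column j
  Matrix : Set c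
  Matrix = ℕ → ℕ → Carrier

  _≈M_ : Matrix → Matrix → Set ℓ
  A ≈M B = ∀ i j → A i j ≈ B i j

  sumTo : ℕ → (ℕ → Carrier) → Carrier
  sumTo zero a = a zero
  sumTo (suc n) a = sumTo n a + a (suc n)

  -- matrix product; for lower triangular left factor (all matrices used here)
  -- this is the full product, since A i k = 0 for k > i
  _·_ : Matrix → Matrix → Matrix
  (A · B) i j = sumTo i (λ k → A i k * B k j)

  I : Matrix
  I zero zero = 1#
  I zero (suc j) = 0#
  I (suc i) zero = 0#
  I (suc i) (suc j) = I i j

  -- coefficients of t^j * f
  shiftBy : ℕ → Series → Series
  shiftBy zero f i = f i
  shiftBy (suc j) f zero = 0#
  shiftBy (suc j) f (suc i) = shiftBy j f i

  tSeries : Series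
  tSeries zero = 0#
  tSeries (suc zero) = 1#
  tSeries (suc (suc i)) = 0#

  IsF0one : Series → Set ℓ
  IsF0one g = g zero ≈ 1#

  IsF1 : Series → Set ℓ
  IsF1 f = (f zero ≈ 0#) × ¬ (f (suc zero) ≈ 0#)

  -- the quasi-Riordan array [g , f]: column 0 is g, column j ≥ 1 is t^(j-1) f
  qr : Series → Series → Matrix
  qr g f i zero = g i
  qr g f i (suc j) = shiftBy j f i

  IsQR : Matrix → Set (c ⊔ ℓ)
  IsQR M = Σ Series (λ g → Σ Series (λ f → IsF0one g × IsF1 f × (M ≈M qr g f)))

  IsInverseQR : Matrix → Matrix → Set (c ⊔ ℓ)
  IsInverseQR M M' = IsQR M' × ((M · M') ≈M I) × ((M' · M) ≈M I)

  InA : Matrix → Set (c ⊔ ℓ)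
  InA M = Σ Series (λ g → IsF0one g × (M ≈M qr g tSeries))

  IsNormalSubgroupA : Set (c ⊔ ℓ)
  IsNormalSubgroupA =
    (∀ M → InA M → IsQR M)
    × InA I
    × (∀ M N → InA M → InA N → InA (M · N))
    × (∀ M M' → InA M → IsInverseQR M M' → InA M')
    × (∀ M D D' → InA M → IsQR D → IsInverseQR D D' → InA ((D · M) · D'))

-- Column j+1 of [g, f] [g', f'] is t^j f f' / t, so [g, f] ↦ f is a homomorphism into
-- the series of order 1 under (f, f') ↦ f f' / t. That operation is commutative and
-- associative with unit t, so conjugating [g, f] by [d, h] turns f into (h f / t) h' / t = f,
-- where [d, h]⁻¹ = [d', h'] forces h h' / t = t (second column of [d, h] [d', h'] = I).
-- A is the kernel of this homomorphism, hence closed under products, inverses and conjugation.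
module Submission where

open import Defs
open import Level using (Level; _⊔_)
open import Data.Nat using (ℕ; zero; suc)
open import Data.Product using (Σ; _×_; _,_)
open import Algebra.Bundles using (CommutativeRing)
import Algebra.Properties.CommutativeSemigroup as CommSemigroupProperties
import Relation.Binary.Reasoning.Setoid as SetoidReasoning

module QuasiRiordanProperties {c ℓ : Level} (K : CommutativeRing c ℓ) where
  open CommutativeRing K hiding (zero)
  open QuasiRiordan K
  open SetoidReasoning setoid
  open CommSemigroupProperties +-commutativeSemigroup using () renaming (interchange to +-interchange)

  infix 4 _≐_
  _≐_ : Series → Series → Set ℓ
  u ≐ v = ∀ m → u m ≈ v m

  tail : Series → Series
  tail a m = a (suc m)

  𝟙 : Series
  𝟙 zero = 1#
  𝟙 (suc m) = 0#

  infixl 7 _⋆_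
  _⋆_ : Series → Series → Series
  (a ⋆ b) zero = a 0 * b 0
  (a ⋆ b) (suc n) = a 0 * b (suc n) + (tail a ⋆ b) n

  ⋆-cong : ∀ {a a′ b b′} → a ≐ a′ → b ≐ b′ → a ⋆ b ≐ a′ ⋆ b′
  ⋆-cong p q zero = *-cong (p 0) (q 0)
  ⋆-cong p q (suc n) = +-cong (*-cong (p 0) (q (suc n))) (⋆-cong (λ m → p (suc m)) q n)

  ⋆-unfoldʳ : ∀ a b n → (a ⋆ b) (suc n) ≈ (a ⋆ tail b) n + a (suc n) * b 0
  ⋆-unfoldʳ a b zero = refl
  ⋆-unfoldʳ a b (suc n) = trans (+-congˡ (⋆-unfoldʳ (tail a) b n)) (sym (+-assoc _ _ _))

  ⋆-comm : ∀ a b → a ⋆ b ≐ b ⋆ a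
  ⋆-comm a b zero = *-comm _ _
  ⋆-comm a b (suc n) = begin
    a 0 * b (suc n) + (tail a ⋆ b) n ≈⟨ +-congˡ (⋆-comm (tail a) b n) ⟩
    a 0 * b (suc n) + (b ⋆ tail a) n ≈⟨ +-comm _ _ ⟩
    (b ⋆ tail a) n + a 0 * b (suc n) ≈⟨ +-congˡ (*-comm _ _) ⟩
    (b ⋆ tail a) n + b (suc n) * a 0 ≈⟨ ⋆-unfoldʳ b a n ⟨
    (b ⋆ a) (suc n)                  ∎

  ⋆-distribʳ-+ : ∀ x y z → (λ m → x m + y m) ⋆ z ≐ λ n → (x ⋆ z) n + (y ⋆ z) n
  ⋆-distribʳ-+ x y z zero = distribʳ _ _ _
  ⋆-distribʳ-+ x y z (suc n) =
    trans (+-cong (distribʳ _ _ _) (⋆-distribʳ-+ (tail x) (tail y) z n)) (+-interchange _ _ _ _)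

  ⋆-scalarˡ : ∀ k x z → (λ m → k * x m) ⋆ z ≐ λ n → k * (x ⋆ z) n
  ⋆-scalarˡ k x z zero = *-assoc _ _ _
  ⋆-scalarˡ k x z (suc n) =
    trans (+-cong (*-assoc _ _ _) (⋆-scalarˡ k (tail x) z n)) (sym (distribˡ _ _ _))

  ⋆-assoc : ∀ a b z → (a ⋆ b) ⋆ z ≐ a ⋆ (b ⋆ z)
  ⋆-assoc a b z zero = *-assoc _ _ _
  ⋆-assoc a b z (suc n) = begin
    (a 0 * b 0) * z (suc n) + ((λ m → a 0 * b (suc m) + (tail a ⋆ b) m) ⋆ z) n
      ≈⟨ +-cong (*-assoc _ _ _) (⋆-distribʳ-+ (λ m → a 0 * b (suc m)) (tail a ⋆ b) z n) ⟩
    a 0 * (b 0 * z (suc n)) + (((λ m → a 0 * b (suc m)) ⋆ z) n + (tail a ⋆ b ⋆ z) n)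
      ≈⟨ +-congˡ (+-cong (⋆-scalarˡ (a 0) (tail b) z n) (⋆-assoc (tail a) b z n)) ⟩
    a 0 * (b 0 * z (suc n)) + (a 0 * (tail b ⋆ z) n + (tail a ⋆ (b ⋆ z)) n)
      ≈⟨ +-assoc _ _ _ ⟨
    (a 0 * (b 0 * z (suc n)) + a 0 * (tail b ⋆ z) n) + (tail a ⋆ (b ⋆ z)) n
      ≈⟨ +-congʳ (distribˡ _ _ _) ⟨
    (a ⋆ (b ⋆ z)) (suc n) ∎

  ⋆-identityʳ : ∀ a → a ⋆ 𝟙 ≐ a
  ⋆-identityʳ a zero = *-identityʳ _
  ⋆-identityʳ a (suc n) = trans (+-cong (zeroʳ _) (⋆-identityʳ (tail a) n)) (+-identityˡ _)

  shiftBy-cong : ∀ j {u v} → u ≐ v → shiftBy j u ≐ shiftBy j v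
  shiftBy-cong zero p i = p i
  shiftBy-cong (suc j) p zero = refl
  shiftBy-cong (suc j) p (suc i) = shiftBy-cong j p i

  shiftBy-zero : ∀ j {u} → u 0 ≈ 0# → shiftBy j u 0 ≈ 0#
  shiftBy-zero zero p = p
  shiftBy-zero (suc j) p = refl

  shiftBy-suc : ∀ j {u} → u 0 ≈ 0# → ∀ i → shiftBy j u (suc i) ≈ shiftBy j (tail u) i
  shiftBy-suc zero p i = refl
  shiftBy-suc (suc j) p zero = shiftBy-zero j p
  shiftBy-suc (suc j) p (suc i) = shiftBy-suc j p i

  ⋆-shiftByʳ : ∀ j a b → a ⋆ shiftBy j b ≐ shiftBy j (a ⋆ b)
  ⋆-shiftByʳ zero a b n = refl
  ⋆-shiftByʳ (suc j) a b zero = zeroʳ _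
  ⋆-shiftByʳ (suc j) a b (suc n) =
    trans (⋆-unfoldʳ a (shiftBy (suc j) b) n)
          (trans (+-cong (⋆-shiftByʳ j a b n) (zeroʳ _)) (+-identityʳ _))

  sumTo-cong : ∀ n {a b : ℕ → Carrier} → (∀ k → a k ≈ b k) → sumTo n a ≈ sumTo n b
  sumTo-cong zero p = p zero
  sumTo-cong (suc n) p = +-cong (sumTo-cong n p) (p (suc n))

  sumTo-unconsˡ : ∀ n (a : ℕ → Carrier) → sumTo (suc n) a ≈ a 0 + sumTo n (λ k → a (suc k))
  sumTo-unconsˡ zero a = refl
  sumTo-unconsˡ (suc n) a = trans (+-congʳ (sumTo-unconsˡ n a)) (+-assoc _ _ _)

  sumTo-shiftBy≈⋆ : ∀ i a v → sumTo i (λ k → shiftBy k a i * v k) ≈ (v ⋆ a) i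
  sumTo-shiftBy≈⋆ zero a v = *-comm _ _
  sumTo-shiftBy≈⋆ (suc i) a v =
    trans (sumTo-unconsˡ i _) (+-cong (*-comm _ _) (sumTo-shiftBy≈⋆ i a (tail v)))

  -- α ⊙ β = α β / t, for series α, β of order at least 1.
  infixl 7 _⊙_
  _⊙_ : Series → Series → Series
  α ⊙ β = shiftBy 1 (tail α ⋆ tail β)

  ⊙-cong : ∀ {α α′ β β′} → α ≐ α′ → β ≐ β′ → α ⊙ β ≐ α′ ⊙ β′
  ⊙-cong p q = shiftBy-cong 1 (⋆-cong (λ m → p (suc m)) (λ m → q (suc m)))

  ⊙-comm : ∀ α β → α ⊙ β ≐ β ⊙ α
  ⊙-comm α β = shiftBy-cong 1 (⋆-comm (tail α) (tail β))

  ⊙-assoc : ∀ α β γ → (α ⊙ β) ⊙ γ ≐ α ⊙ (β ⊙ γ)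
  ⊙-assoc α β γ = shiftBy-cong 1 (⋆-assoc (tail α) (tail β) (tail γ))

  ⊙-identityʳ : ∀ β → β 0 ≈ 0# → β ⊙ tSeries ≐ β
  ⊙-identityʳ β β₀ zero = sym β₀
  ⊙-identityʳ β β₀ (suc m) = trans (⋆-cong (λ _ → refl) tail-t≐𝟙 m) (⋆-identityʳ (tail β) m)
    where
    tail-t≐𝟙 : tail tSeries ≐ 𝟙
    tail-t≐𝟙 zero = refl
    tail-t≐𝟙 (suc m) = refl

  ⊙-identityˡ : ∀ β → β 0 ≈ 0# → tSeries ⊙ β ≐ β
  ⊙-identityˡ β β₀ m = trans (⊙-comm tSeries β m) (⊙-identityʳ β β₀ m)

  ⊙-cancel-inverse : ∀ f h h′ → f 0 ≈ 0# → h ⊙ h′ ≐ tSeries → (h ⊙ f) ⊙ h′ ≐ f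
  ⊙-cancel-inverse f h h′ f₀ hh′ m = begin
    ((h ⊙ f) ⊙ h′) m     ≈⟨ ⊙-cong {β = h′} (⊙-comm h f) (λ _ → refl) m ⟩
    ((f ⊙ h) ⊙ h′) m     ≈⟨ ⊙-assoc f h h′ m ⟩
    (f ⊙ (h ⊙ h′)) m     ≈⟨ ⊙-cong {α = f} (λ _ → refl) hh′ m ⟩
    (f ⊙ tSeries) m      ≈⟨ ⊙-identityʳ f f₀ m ⟩
    f m                  ∎

  col₀ : Matrix → Series
  col₀ M i = M i 0

  transM : ∀ {A B C} → A ≈M B → B ≈M C → A ≈M C
  transM p q i j = trans (p i j) (q i j)

  symM : ∀ {A B} → A ≈M B → B ≈M A
  symM p i j = sym (p i j)

  ·-cong : ∀ {A A′ B B′} → A ≈M A′ → B ≈M B′ → (A · B) ≈M (A′ · B′)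
  ·-cong p q i j = sumTo-cong i (λ k → *-cong (p i k) (q k j))

  qr-cong : ∀ e {α β} → α ≐ β → qr e α ≈M qr e β
  qr-cong e p i zero = refl
  qr-cong e p i (suc j) = shiftBy-cong j p i

  qr-injectiveʳ : ∀ {a α b β} → qr a α ≈M qr b β → α ≐ β
  qr-injectiveʳ p i = p i 1

  I≈qr-t : I ≈M qr (col₀ I) tSeries
  I≈qr-t i zero = refl
  I≈qr-t zero (suc zero) = refl
  I≈qr-t zero (suc (suc j)) = refl
  I≈qr-t (suc zero) (suc zero) = refl
  I≈qr-t (suc (suc i)) (suc zero) = refl
  I≈qr-t (suc i) (suc (suc j)) = I≈qr-t i (suc j)

  qr-·-qr : ∀ a α b β → α 0 ≈ 0# → β 0 ≈ 0# →
            (qr a α · qr b β) ≈M qr (col₀ (qr a α · qr b β)) (α ⊙ β)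
  qr-·-qr a α b β α₀ β₀ i zero = refl
  qr-·-qr a α b β α₀ β₀ zero (suc j) =
    trans (trans (*-congˡ (shiftBy-zero j β₀)) (zeroʳ _)) (sym (shiftBy-zero j refl))
  qr-·-qr a α b β α₀ β₀ (suc i) (suc j) = begin
    (qr a α · qr b β) (suc i) (suc j)
      ≈⟨ sumTo-unconsˡ i _ ⟩
    a (suc i) * shiftBy j β 0 + sumTo i (λ k → shiftBy k α (suc i) * shiftBy j β (suc k))
      ≈⟨ +-cong (trans (*-congˡ (shiftBy-zero j β₀)) (zeroʳ _))
                (sumTo-cong i (λ k → *-cong (shiftBy-suc k α₀ i) (shiftBy-suc j β₀ k))) ⟩
    0# + sumTo i (λ k → shiftBy k (tail α) i * shiftBy j (tail β) k)
      ≈⟨ trans (+-identityˡ _) (sumTo-shiftBy≈⋆ i (tail α) (shiftBy j (tail β))) ⟩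
    (shiftBy j (tail β) ⋆ tail α) i
      ≈⟨ ⋆-comm _ _ i ⟩
    (tail α ⋆ shiftBy j (tail β)) i
      ≈⟨ ⋆-shiftByʳ j (tail α) (tail β) i ⟩
    shiftBy j (tail α ⋆ tail β) i
      ≈⟨ shiftBy-suc j {α ⊙ β} refl i ⟨
    shiftBy j (α ⊙ β) (suc i) ∎

  -- The set R(f)_r of the paper; InA M unfolds to M ∈R[ tSeries ].
  _∈R[_] : Matrix → Series → Set (c ⊔ ℓ)
  M ∈R[ f ] = Σ Series (λ e → IsF0one e × (M ≈M qr e f))

  ∈R-cong : ∀ {M α β} → α ≐ β → M ∈R[ α ] → M ∈R[ β ]
  ∈R-cong p (e , e₁ , M≈) = e , e₁ , transM M≈ (qr-cong e p)

  ·-∈R : ∀ {A B α β} → α 0 ≈ 0# → β 0 ≈ 0# → A ∈R[ α ] → B ∈R[ β ] → (A · B) ∈R[ α ⊙ β ]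
  ·-∈R {A} {B} {α} {β} α₀ β₀ (a , a₁ , A≈) (b , b₁ , B≈) =
    col₀ (A · B) ,
    trans (*-cong (trans (A≈ 0 0) a₁) (trans (B≈ 0 0) b₁)) (*-identityˡ 1#) ,
    λ i j → qr-col₀ i j
    where
    AB≈ : (A · B) ≈M qr (col₀ (qr a α · qr b β)) (α ⊙ β)
    AB≈ = transM (·-cong A≈ B≈) (qr-·-qr a α b β α₀ β₀)
    qr-col₀ : (A · B) ≈M qr (col₀ (A · B)) (α ⊙ β)
    qr-col₀ i zero = refl
    qr-col₀ i (suc j) = AB≈ i (suc j)

  ⊙-inverse : ∀ {A B α β} → α 0 ≈ 0# → β 0 ≈ 0# → A ∈R[ α ] → B ∈R[ β ] →
              (A · B) ≈M I → α ⊙ β ≐ tSeries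
  ⊙-inverse α₀ β₀ A∈ B∈ AB≈I with ·-∈R α₀ β₀ A∈ B∈
  ... | _ , _ , AB≈ = qr-injectiveʳ (transM (symM AB≈) (transM AB≈I I≈qr-t))

  conjugate-∈R : ∀ {D N D′ f h h′} → f 0 ≈ 0# → h 0 ≈ 0# → h′ 0 ≈ 0# →
                 D ∈R[ h ] → N ∈R[ f ] → D′ ∈R[ h′ ] → (D · D′) ≈M I → ((D · N) · D′) ∈R[ f ]
  conjugate-∈R {f = f} {h} {h′} f₀ h₀ h′₀ D∈ N∈ D′∈ DD′≈I =
    ∈R-cong (⊙-cancel-inverse f h h′ f₀ (⊙-inverse h₀ h′₀ D∈ D′∈ DD′≈I))
            (·-∈R refl h′₀ (·-∈R h₀ f₀ D∈ N∈) D′∈)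

  reflM : ∀ {A} → A ≈M A
  reflM i j = refl

  conjugate-qr : ∀ g f d h D′ → IsF0one g → IsF1 f → IsF0one d → IsF1 h →
                 IsInverseQR (qr d h) D′ → ((qr d h · qr g f) · D′) ∈R[ f ]
  conjugate-qr g f d h D′ g₁ (f₀ , _) d₁ (h₀ , _) ((_ , h′ , d′₁ , (h′₀ , _) , D′≈) , DD′≈I , _) =
    conjugate-∈R f₀ h₀ h′₀ (d , d₁ , reflM) (g , g₁ , reflM) (_ , d′₁ , D′≈) DD′≈I

  t-IsF1 : IsField K → IsF1 tSeries
  t-IsF1 F = refl , λ 0≈1 → IsField.0≉1 F (sym 0≈1)

  A-normal : IsField K → IsNormalSubgroupA
  A-normal F = A⊆R , I∈A , A-·-closed , A-inverse-closed , A-conjugate-closed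
    where
    A⊆R : ∀ M → InA M → IsQR M
    A⊆R M (g , g₁ , M≈) = g , tSeries , g₁ , t-IsF1 F , M≈

    I∈A : InA I
    I∈A = col₀ I , refl , I≈qr-t

    A-·-closed : ∀ M N → InA M → InA N → InA (M · N)
    A-·-closed M N M∈ N∈ = ∈R-cong (⊙-identityˡ tSeries refl) (·-∈R refl refl M∈ N∈)

    A-inverse-closed : ∀ M M′ → InA M → IsInverseQR M M′ → InA M′
    A-inverse-closed M M′ M∈ ((g′ , f′ , g′₁ , (f′₀ , _) , M′≈) , MM′≈I , _) =
      ∈R-cong f′≐t (g′ , g′₁ , M′≈)
      where
      f′≐t : f′ ≐ tSeries
      f′≐t m = trans (sym (⊙-identityˡ f′ f′₀ m)) (⊙-inverse refl f′₀ M∈ (g′ , g′₁ , M′≈) MM′≈I m)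

    A-conjugate-closed : ∀ M D D′ → InA M → IsQR D → IsInverseQR D D′ → InA ((D · M) · D′)
    A-conjugate-closed M D D′ M∈ (d , h , d₁ , (h₀ , _) , D≈) ((_ , h′ , d′₁ , (h′₀ , _) , D′≈) , DD′≈I , _) =
      conjugate-∈R refl h₀ h′₀ (d , d₁ , D≈) M∈ (_ , d′₁ , D′≈) DD′≈I

theorem3p4 : {c ℓ : Level} (K : CommutativeRing c ℓ) → IsField K →
    let open CommutativeRing K
        open QuasiRiordan K
    in (∀ g f d h D' → IsF0one g → IsF1 f → IsF0one d → IsF1 h →
          IsInverseQR (qr d h) D' →
          Σ Series (λ e → IsF0one e × (((qr d h · qr g f) · D') ≈M qr e f)))
       × IsNormalSubgroupA
theorem3p4 K F = conjugate-qr , A-normal F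
  where open QuasiRiordanProperties K
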